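{- Let $\langle A,f,g\rangle$ be a PS-algebra satisfying, for all $x,y,z\in A$, $x\le f(x,x)$, $y\cdot f(x,z)\le f(x\cdot f(x,y),z)$, and $f(x,g(x,-y)\cdot y)\le y$. Then the following are equivalent: (i) for all $a\ne 0$, $g(a,a)\le a$; (ii) for all $a,b\in A$, $a\cdot b\neq 0\rightarrow g(a,b)\le f(a,b)$.
   Context: $A$ is a non-trivial Boolean algebra ($+,\cdot,-,0,1$). A PS-algebra $\langle A,f,g\rangle$ has $f:A^2\to A$ with $f(0,y)=f(x,0)=0$ and additive in each argument, and $g:A^2\to A$ with $g(0,y)=g(x,0)=1$, $g(x+x',y)=g(x,y)\cdot g(x',y)$ and $g(x,y+y')=g(x,y)\cdot g(x,y')$. -}

module Defs where

open import Level using (Level; _⊔_; suc)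
open import Relation.Nullary using (¬_)
open import Algebra.Lattice.Bundles using (BooleanAlgebra)

-- Boolean operations: + is _∨_, · is _∧_, - is ¬_, 0 is ⊥, 1 is ⊤.
-- Equality of the algebra is the setoid equality _≈_ of B, so f and g are
-- required to respect it (automatic when _≈_ is propositional equality).
record PSAlgebra {c ℓ : Level} (B : BooleanAlgebra c ℓ) : Set (c ⊔ ℓ) where
  open BooleanAlgebra B renaming (¬_ to -_)
  field
    nontrivial : ¬ (⊤ ≈ ⊥)
    f : Carrier → Carrier → Carrier
    g : Carrier → Carrier → Carrier
    f-cong : ∀ {x x' y y'} → x ≈ x' → y ≈ y' → f x y ≈ f x' y'
    g-cong : ∀ {x x' y y'} → x ≈ x' → y ≈ y' → g x y ≈ g x' y'
    f-0ˡ : ∀ y → f ⊥ y ≈ ⊥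
    f-0ʳ : ∀ x → f x ⊥ ≈ ⊥
    f-addˡ : ∀ x x' y → f (x ∨ x') y ≈ f x y ∨ f x' y
    f-addʳ : ∀ x y y' → f x (y ∨ y') ≈ f x y ∨ f x y'
    g-0ˡ : ∀ y → g ⊥ y ≈ ⊤
    g-0ʳ : ∀ x → g x ⊥ ≈ ⊤
    g-multˡ : ∀ x x' y → g (x ∨ x') y ≈ g x y ∧ g x' y
    g-multʳ : ∀ x y y' → g x (y ∨ y') ≈ g x y ∧ g x y'

module Order {c ℓ : Level} (B : BooleanAlgebra c ℓ) where
  open BooleanAlgebra B renaming (¬_ to -_)
  _≤_ : Carrier → Carrier → Set ℓ
  x ≤ y = (x ∧ y) ≈ x

{-# OPTIONS --safe #-}
-- (i) ⇒ (ii): for a · b ≠ 0, antitonicity of g and monotonicity of f squeeze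
-- g(a,b) ≤ g(ab,ab) ≤ ab ≤ f(ab,ab) ≤ f(a,b), the middle step being x ≤ f(x,x).
-- (ii) ⇒ (i): put c = g(a,a) · -a. The third axiom with y = -a gives f(a,c) ≤ -a,
-- so a · f(a,c) = 0, while (ii) gives c ≤ f(a,a). The second axiom then yields
-- c = c · f(a,a) ≤ f(a · f(a,c), a) = f(0,a) = 0, i.e. g(a,a) ≤ a.
module Submission where

open import Defs
open import Level using (Level)
open import Function.Bundles using (_⇔_; mk⇔)
open import Relation.Nullary using (¬_)
open import Algebra.Lattice.Bundles using (BooleanAlgebra)
import Algebra.Lattice.Properties.BooleanAlgebra as BooleanAlgebraProperties
import Relation.Binary.Lattice as OrderTheoretic
import Relation.Binary.Lattice.Properties.JoinSemilattice as JoinSemilatticeProperties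
import Relation.Binary.Lattice.Properties.MeetSemilattice as MeetSemilatticeProperties
import Relation.Binary.Reasoning.Setoid as SetoidReasoning

module BooleanOrderProperties {c ℓ : Level} (B : BooleanAlgebra c ℓ) where
  open BooleanAlgebra B renaming (¬_ to -_)
  open BooleanAlgebraProperties B
  open Order B
  open SetoidReasoning setoid

  -- The library orders a lattice by x ≈ x ∧ y, the converse equation of _≤_.
  private
    module L = OrderTheoretic.Lattice ∨-∧-orderTheoreticLattice

  ≤-reflexive : ∀ {x y} → x ≈ y → x ≤ y
  ≤-reflexive x≈y = sym (L.reflexive x≈y)

  ≤-trans : ∀ {x y z} → x ≤ y → y ≤ z → x ≤ z
  ≤-trans x≤y y≤z = sym (L.trans (sym x≤y) (sym y≤z))

  ≤-respˡ-≈ : ∀ {x x' y} → x ≈ x' → x' ≤ y → x ≤ y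
  ≤-respˡ-≈ x≈x' x'≤y = ≤-trans (≤-reflexive x≈x') x'≤y

  x∧y≤x : ∀ x y → (x ∧ y) ≤ x
  x∧y≤x x y = sym (L.x∧y≤x x y)

  x∧y≤y : ∀ x y → (x ∧ y) ≤ y
  x∧y≤y x y = sym (L.x∧y≤y x y)

  x≤x∨y : ∀ x y → x ≤ (x ∨ y)
  x≤x∨y x y = sym (L.x≤x∨y x y)

  ∧-monotonic : ∀ {x x' y y'} → x ≤ x' → y ≤ y' → (x ∧ y) ≤ (x' ∧ y')
  ∧-monotonic x≤x' y≤y' =
    sym (MeetSemilatticeProperties.∧-monotonic L.meetSemilattice (sym x≤x') (sym y≤y'))

  x≤y⇒x∨y≈y : ∀ {x y} → x ≤ y → (x ∨ y) ≈ y
  x≤y⇒x∨y≈y x≤y = JoinSemilatticeProperties.x≤y⇒x∨y≈y L.joinSemilattice (sym x≤y)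

  x≤⊥⇒x≈⊥ : ∀ {x} → x ≤ ⊥ → x ≈ ⊥
  x≤⊥⇒x≈⊥ {x} x≤⊥ = trans (sym x≤⊥) (∧-zeroʳ x)

  x∧-y≈⊥⇒x≤y : ∀ {x y} → (x ∧ - y) ≈ ⊥ → x ≤ y
  x∧-y≈⊥⇒x≤y {x} {y} x∧-y≈⊥ = begin
    x ∧ y               ≈⟨ ∨-identityʳ (x ∧ y) ⟨
    (x ∧ y) ∨ ⊥         ≈⟨ ∨-congˡ x∧-y≈⊥ ⟨
    (x ∧ y) ∨ (x ∧ - y) ≈⟨ ∧-distribˡ-∨ x y (- y) ⟨
    x ∧ (y ∨ - y)       ≈⟨ ∧-congˡ (∨-complementʳ y) ⟩
    x ∧ ⊤               ≈⟨ ∧-identityʳ x ⟩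
    x                   ∎

  x≉⊥⇒x∧x≉⊥ : ∀ {x} → ¬ (x ≈ ⊥) → ¬ ((x ∧ x) ≈ ⊥)
  x≉⊥⇒x∧x≉⊥ {x} x≉⊥ x∧x≈⊥ = x≉⊥ (trans (sym (∧-idem x)) x∧x≈⊥)

  join-preserving⇒monotone : (h : Carrier → Carrier) →
    (∀ {x y} → x ≈ y → h x ≈ h y) → (∀ x y → h (x ∨ y) ≈ h x ∨ h y) →
    ∀ {x y} → x ≤ y → h x ≤ h y
  join-preserving⇒monotone h h-cong h-∨ {x} {y} x≤y = begin
    h x ∧ h y         ≈⟨ ∧-congˡ (h-cong (x≤y⇒x∨y≈y x≤y)) ⟨
    h x ∧ h (x ∨ y)   ≈⟨ ∧-congˡ (h-∨ x y) ⟩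
    h x ∧ (h x ∨ h y) ≈⟨ x≤x∨y (h x) (h y) ⟩
    h x               ∎

  join-to-meet⇒antitone : (h : Carrier → Carrier) →
    (∀ {x y} → x ≈ y → h x ≈ h y) → (∀ x y → h (x ∨ y) ≈ h x ∧ h y) →
    ∀ {x y} → x ≤ y → h y ≤ h x
  join-to-meet⇒antitone h h-cong h-∨ {x} {y} x≤y =
    ≤-respˡ-≈ (trans (h-cong (sym (x≤y⇒x∨y≈y x≤y))) (h-∨ x y)) (x∧y≤x (h x) (h y))

module PSAlgebraProperties {c ℓ : Level} {B : BooleanAlgebra c ℓ} (P : PSAlgebra B) where
  open BooleanAlgebra B renaming (¬_ to -_)
  open BooleanAlgebraProperties B using (¬-involutive)
  open PSAlgebra P
  open Order B
  open BooleanOrderProperties B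
  open SetoidReasoning setoid

  f-monoˡ : ∀ {x x'} y → x ≤ x' → f x y ≤ f x' y
  f-monoˡ y = join-preserving⇒monotone (λ x → f x y) (λ e → f-cong e refl) (λ x x' → f-addˡ x x' y)

  f-monoʳ : ∀ x {y y'} → y ≤ y' → f x y ≤ f x y'
  f-monoʳ x = join-preserving⇒monotone (f x) (f-cong refl) (f-addʳ x)

  g-antiˡ : ∀ {x x'} y → x ≤ x' → g x' y ≤ g x y
  g-antiˡ y = join-to-meet⇒antitone (λ x → g x y) (λ e → g-cong e refl) (λ x x' → g-multˡ x x' y)

  g-antiʳ : ∀ x {y y'} → y ≤ y' → g x y' ≤ g x y
  g-antiʳ x = join-to-meet⇒antitone (g x) (g-cong refl) (g-multʳ x)

  GDeflationaryOnDiagonal : Set _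
  GDeflationaryOnDiagonal = ∀ a → ¬ (a ≈ ⊥) → g a a ≤ a

  GDominatedByF : Set _
  GDominatedByF = ∀ a b → ¬ ((a ∧ b) ≈ ⊥) → g a b ≤ f a b

  deflationary⇒dominated : (∀ x → x ≤ f x x) →
    GDeflationaryOnDiagonal → GDominatedByF
  deflationary⇒dominated x≤fxx deflationary a b ab≉⊥ =
    ≤-trans (g-antiˡ b (x∧y≤x a b))
    (≤-trans (g-antiʳ (a ∧ b) (x∧y≤y a b))
    (≤-trans (deflationary (a ∧ b) ab≉⊥)
    (≤-trans (x≤fxx (a ∧ b))
    (≤-trans (f-monoˡ (a ∧ b) (x∧y≤x a b)) (f-monoʳ a (x∧y≤y a b))))))

  f-disjoint⇒⊥ : (∀ x y z → (y ∧ f x z) ≤ f (x ∧ f x y) z) →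
    ∀ {a c} → (a ∧ f a c) ≈ ⊥ → c ≤ f a a → c ≈ ⊥
  f-disjoint⇒⊥ axiom {a} {c} a∧fac≈⊥ c≤faa = x≤⊥⇒x≈⊥ (begin
    c ∧ ⊥                         ≈⟨ ∧-congˡ (trans (f-cong a∧fac≈⊥ refl) (f-0ˡ a)) ⟨
    c ∧ f (a ∧ f a c) a           ≈⟨ ∧-congʳ c≤faa ⟨
    (c ∧ f a a) ∧ f (a ∧ f a c) a ≈⟨ axiom a c a ⟩
    c ∧ f a a                     ≈⟨ c≤faa ⟩
    c                             ∎)

  dominated⇒deflationary : (∀ x y z → (y ∧ f x z) ≤ f (x ∧ f x y) z) →
    (∀ x y → f x (g x (- y) ∧ y) ≤ y) →
    GDominatedByF → GDeflationaryOnDiagonal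
  dominated⇒deflationary axiom₂ axiom₃ dominated a a≉⊥ =
    x∧-y≈⊥⇒x≤y (f-disjoint⇒⊥ axiom₂ a∧f≈⊥ (≤-trans (x∧y≤x (g a a) (- a)) gaa≤faa))
    where
    f≤-a : f a (g a a ∧ - a) ≤ (- a)
    f≤-a = ≤-respˡ-≈ (f-cong refl (∧-congʳ (g-cong refl (sym (¬-involutive a))))) (axiom₃ a (- a))

    a∧f≈⊥ : (a ∧ f a (g a a ∧ - a)) ≈ ⊥
    a∧f≈⊥ = x≤⊥⇒x≈⊥ (≤-trans (∧-monotonic (≤-reflexive refl) f≤-a) (≤-reflexive (∧-complementʳ a)))

    gaa≤faa : g a a ≤ f a a
    gaa≤faa = dominated a a (x≉⊥⇒x∧x≉⊥ a≉⊥)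

lemma6p12 : {c ℓ : Level} (B : BooleanAlgebra c ℓ) (P : PSAlgebra B) →
    let open BooleanAlgebra B renaming (¬_ to -_)
        open PSAlgebra P
        open Order B
    in (∀ x → x ≤ f x x) →
       (∀ x y z → (y ∧ f x z) ≤ f (x ∧ f x y) z) →
       (∀ x y → f x (g x (- y) ∧ y) ≤ y) →
       ((∀ a → ¬ (a ≈ ⊥) → g a a ≤ a) ⇔
        (∀ a b → ¬ ((a ∧ b) ≈ ⊥) → g a b ≤ f a b))
lemma6p12 B P axiom₁ axiom₂ axiom₃ =
  mk⇔ (deflationary⇒dominated axiom₁) (dominated⇒deflationary axiom₂ axiom₃)
  where open PSAlgebraProperties P
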